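{- Let $G$ be a finite DAG with leaf set $X$ that has the $k$-$\mathrm{lca}$-property ($k\ge 1$). Then $G$ has the strict $k$-$\mathrm{lca}$-property if and only if $\mathscr{C}_G$ is a $k$-ary $\mathscr{T}$-system. In this case $\mathscr{C}_G=\{R_G(U)\mid U\in X^{(k)}\}$, where $R_G(U)=\mathrm{C}(\mathrm{lca}(U))$, i.e. $\mathscr{C}_G$ is identified by $R_G$.
   Context: For a finite DAG $G$, write $v\preceq w$ if there is a directed path (possibly of length $0$) from $w$ to $v$; the leaf set $X$ is the set of $\preceq$-minimal vertices; $\mathrm{C}(v)=\{x\in X\mid x\preceq v\}$ and $\mathscr{C}_G=\{\mathrm{C}(v)\mid v\in V(G)\}$. $X^{(k)}$ is the set of non-empty subsets of $X$ of size at most $k$. A least common ancestor of $Y\subseteq V(G)$ is a $\preceq$-minimal element of the set of common ancestors of all elements of $Y$; $\mathrm{lca}(Y)$ is defined (and equals $q$) if $q$ is the only such vertex. $G$ has the $k$-$\mathrm{lca}$-property if $\mathrm{lca}(A)$ is defined for all $A\in X^{(k)}$. $G$ has the strict $k$-$\mathrm{lca}$-property if it has the $k$-$\mathrm{lca}$-property, $\mathrm{lca}(\mathrm{C}(v))$ is defined for every $v\in V(G)$, and for every $w\in V(G)$ there is $U\in X^{(k)}$ with $\mathrm{lca}(\mathrm{C}(w))=\mathrm{lca}(U)$. A set system $\mathscr{C}$ of non-empty subsets of $X$ is a $k$-ary $\mathscr{T}$-system if (KS) $\{x\}\in\mathscr{C}$ for all $x\in X$; (KR) for every $C\in\mathscr{C}$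 there is $T\subseteq C$ with $|T|\le k$ such that for all $C'\in\mathscr{C}$, $T\subseteq C'$ implies $C\subseteq C'$; (KC) for every $U\in X^{(k)}$, $\bigcap\{C\in\mathscr{C}\mid U\subseteq C\}\in\mathscr{C}$. -}

module Defs where

open import Data.Nat using (ℕ; _≤_)
open import Data.Bool using (Bool; T)
open import Data.Fin using (Fin)
open import Data.Fin.Subset using (Subset; _∈_; _⊆_; ∣_∣; Nonempty)
open import Data.Product using (Σ; ∃; _×_; _,_)
open import Relation.Binary.PropositionalEquality using (_≡_)
open import Relation.Binary.Construct.Closure.ReflexiveTransitive using (Star)
open import Relation.Nullary using (¬_)
open import Function.Bundles using (_⇔_)

Edge : {n : ℕ} → (Fin n → Fin n → Bool) → Fin n → Fin n → Set
Edge E u v = T (E u v)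

_≼[_]_ : {n : ℕ} → Fin n → (Fin n → Fin n → Bool) → Fin n → Set
v ≼[ E ] w = Star (Edge E) w v

record DAG (n : ℕ) : Set where
  field
    E       : Fin n → Fin n → Bool
    acyclic : ∀ u v → Edge E u v → ¬ (u ≼[ E ] v)

module _ {n : ℕ} where

  InXk : (Fin n → Set) → ℕ → Subset n → Set
  InXk X k U = (∀ x → x ∈ U → X x) × Nonempty U × ∣ U ∣ ≤ k

  record KarySystem (X : Fin n → Set) (k : ℕ) (𝒞 : Subset n → Set) : Set₁ where
    field
      members : ∀ C → 𝒞 C → (∀ x → x ∈ C → X x) × Nonempty C
      KS : ∀ x → X x → ∃ λ S → 𝒞 S × (∀ y → y ∈ S ⇔ y ≡ x)
      KR : ∀ C → 𝒞 C → ∃ λ T → T ⊆ C × ∣ T ∣ ≤ k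
             × (∀ C' → 𝒞 C' → T ⊆ C' → C ⊆ C')
      KC : ∀ U → InXk X k U → ∃ λ S → 𝒞 S
             × (∀ x → x ∈ S ⇔ (X x × (∀ C → 𝒞 C → U ⊆ C → x ∈ C)))

module _ {n : ℕ} (G : DAG n) where
  open DAG G

  _≼_ : Fin n → Fin n → Set
  v ≼ w = v ≼[ E ] w

  Leaf : Fin n → Set
  Leaf x = ∀ v → v ≼ x → v ≡ x

  Cl : Fin n → Fin n → Set
  Cl v x = Leaf x × (x ≼ v)

  RepC : Subset n → Fin n → Set
  RepC S v = ∀ x → (x ∈ S) ⇔ Cl v x

  𝒞G : Subset n → Set
  𝒞G S = ∃ λ v → RepC S v

  CommonAnc : (Fin n → Set) → Fin n → Set
  CommonAnc Y q = ∀ y → Y y → y ≼ q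

  IsLCA : (Fin n → Set) → Fin n → Set
  IsLCA Y q = CommonAnc Y q × (∀ w → CommonAnc Y w → w ≼ q → w ≡ q)

  LcaIs : (Fin n → Set) → Fin n → Set
  LcaIs Y q = IsLCA Y q × (∀ q' → IsLCA Y q' → q' ≡ q)

  X : Fin n → Set
  X = Leaf

  kLcaProperty : ℕ → Set
  kLcaProperty k = ∀ A → InXk X k A → ∃ λ q → LcaIs (_∈ A) q

  StrictKLcaProperty : ℕ → Set
  StrictKLcaProperty k =
    kLcaProperty k
    × (∀ v → ∃ λ q → LcaIs (Cl v) q)
    × (∀ w → ∃ λ U → InXk X k U × ∃ λ q → LcaIs (Cl w) q × LcaIs (_∈ U) q)

  IdentifiedByR : ℕ → Set
  IdentifiedByR k =
    ∀ S → 𝒞G S ⇔ (∃ λ U → InXk X k U × ∃ λ q → LcaIs (_∈ U) q × RepC S q)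

-- Strict reachability in a finite DAG is a strict partial order on Fin n,
-- hence well-founded; by well-founded induction reachability is decidable and
-- every C(v) is non-empty.  A common ancestor w of a decidable set Y thus lies
-- above a minimal common ancestor, which must be lca(Y); so Y ⊆ C(v) forces
-- C(lca Y) ⊆ C(v), and in particular C(lca C(v)) = C(v).  Given the strict
-- property, the set U with lca U = lca C(v) is a (KR)-witness for C(v) and
-- shows C(v) = R_G(U), while C(lca U) is the intersection required by (KC).
-- Conversely a (KR)-witness T of C(v), replaced by a singleton if empty, has
-- C(v) ⊆ C(lca T); so lca T is a common ancestor of C(v) ⊇ T, whence
-- lca C(v) = lca T.
module Submission where

open import Defs
open import Level using (0ℓ)
open import Data.Nat using (ℕ; _≤_)
open import Data.Product using (_×_; ∃; ∃-syntax; _,_; proj₁; proj₂)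
open import Data.Empty using (⊥-elim)
open import Data.Fin using (Fin; _≟_)
open import Data.Fin.Subset using (Subset; _∈_; _⊆_; ∣_∣; Nonempty; ⁅_⁆)
open import Data.Fin.Subset.Properties
  using (_∈?_; nonempty?; x∈⁅x⁆; x∈⁅y⁆⇔x≡y; ∣⁅x⁆∣≡1)
open import Data.Fin.Properties using (any?; all?)
open import Data.Fin.Induction using (spo-wellFounded)
open import Data.Vec using (tabulate; lookup)
open import Data.Vec.Properties using (lookup∘tabulate; []=⇒lookup; lookup⇒[]=)
open import Function.Base using (_∘_)
open import Function.Bundles using (_⇔_; mk⇔; Equivalence)
open import Function.Construct.Composition using (_⇔-∘_)
open import Function.Construct.Symmetry using (⇔-sym)
open import Induction.WellFounded using (WellFounded; WfRec; module All)
open import Relation.Binary.Structures using (IsStrictPartialOrder)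
open import Relation.Binary.PropositionalEquality
  using (_≡_; _≢_; refl; sym; trans; subst; isEquivalence; resp₂)
open import Relation.Binary.Construct.Closure.ReflexiveTransitive
  using (ε; _◅_; _◅◅_)
open import Relation.Nullary using (Dec; yes; no; does; ¬_; ¬?; _×-dec_; _→-dec_)
open import Relation.Nullary.Decidable
  using (T?; map′; dec-true; decidable-stable)
import Relation.Nullary.Decidable as Dec
open import Relation.Unary as Unary using (Decidable)

open Equivalence using (to; from)

module _ {n : ℕ} {P : Fin n → Set} where

  subset : Decidable P → Subset n
  subset P? = tabulate (does ∘ P?)

  ∈-subset⇔ : (P? : Decidable P) → ∀ x → x ∈ subset P? ⇔ P x
  ∈-subset⇔ P? x = mk⇔ ∈⇒P P⇒∈
    where
    lookup-subset : lookup (subset P?) x ≡ does (P? x)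
    lookup-subset = lookup∘tabulate (does ∘ P?) x

    ∈⇒P : x ∈ subset P? → P x
    ∈⇒P x∈ with P? x | trans (sym ([]=⇒lookup x∈)) lookup-subset
    ... | yes px | _ = px
    ... | no _   | ()

    P⇒∈ : P x → x ∈ subset P?
    P⇒∈ px = lookup⇒[]= x (subset P?) (trans lookup-subset (dec-true (P? x) px))

module Reachability {n : ℕ} (G : DAG n) where
  open DAG G

  ≼-trans : ∀ {u v w} → u ≼[ E ] v → v ≼[ E ] w → u ≼[ E ] w
  ≼-trans u≼v v≼w = v≼w ◅◅ u≼v

  infix 4 _≺_
  _≺_ : Fin n → Fin n → Set
  u ≺ w = ∃[ v ] Edge E w v × u ≼[ E ] v

  ≺⇒≼ : ∀ {u w} → u ≺ w → u ≼[ E ] w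
  ≺⇒≼ (_ , e , u≼v) = e ◅ u≼v

  edge⇒≺ : ∀ {v w} → Edge E w v → v ≺ w
  edge⇒≺ e = _ , e , ε

  ≼∧≢⇒≺ : ∀ {u w} → u ≼[ E ] w → u ≢ w → u ≺ w
  ≼∧≢⇒≺ ε        u≢u = ⊥-elim (u≢u refl)
  ≼∧≢⇒≺ (e ◅ u≼v) _   = _ , e , u≼v

  ≺-irrefl : ∀ {u} → ¬ u ≺ u
  ≺-irrefl {u} (v , e , u≼v) = acyclic u v e u≼v

  ≺-trans : ∀ {u v w} → u ≺ v → v ≺ w → u ≺ w
  ≺-trans u≺v (b , e , v≼b) = b , e , ≼-trans (≺⇒≼ u≺v) v≼b

  ≺-isStrictPartialOrder : IsStrictPartialOrder _≡_ _≺_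
  ≺-isStrictPartialOrder = record
    { isEquivalence = isEquivalence
    ; irrefl        = λ { refl → ≺-irrefl }
    ; trans         = ≺-trans
    ; <-resp-≈      = resp₂ _≺_
    }

  ≺-wellFounded : WellFounded _≺_
  ≺-wellFounded = spo-wellFounded ≺-isStrictPartialOrder

  open All ≺-wellFounded 0ℓ using (wfRec)

  _≼?_ : ∀ u w → Dec (u ≼[ E ] w)
  u ≼? w = wfRec (λ w → ∀ u → Dec (u ≼[ E ] w)) step w u
    where
    step : ∀ w → WfRec _≺_ (λ w → ∀ u → Dec (u ≼[ E ] w)) w → ∀ u → Dec (u ≼[ E ] w)
    step w below? u with u ≟ w
    ... | yes refl = yes ε
    ... | no u≢w   = map′ ≺⇒≼ (λ u≼w → ≼∧≢⇒≺ u≼w u≢w) (any? through)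
      where
      through : ∀ v → Dec (Edge E w v × u ≼[ E ] v)
      through v with T? (E w v)
      ... | no ¬e = no (¬e ∘ proj₁)
      ... | yes e = map′ (e ,_) proj₂ (below? (edge⇒≺ e) u)

  noOutEdge⇔Leaf : ∀ {x} → (∀ v → ¬ Edge E x v) ⇔ Leaf G x
  noOutEdge⇔Leaf {x} = mk⇔ noOutEdge⇒Leaf Leaf⇒noOutEdge
    where
    noOutEdge⇒Leaf : (∀ v → ¬ Edge E x v) → Leaf G x
    noOutEdge⇒Leaf _      _ ε       = refl
    noOutEdge⇒Leaf noEdge _ (e ◅ _) = ⊥-elim (noEdge _ e)

    Leaf⇒noOutEdge : Leaf G x → ∀ v → ¬ Edge E x v
    Leaf⇒noOutEdge leaf v e = acyclic x v e (subst (_≼[ E ] v) (leaf v (e ◅ ε)) ε)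

  leaf? : Decidable (Leaf G)
  leaf? x = Dec.map noOutEdge⇔Leaf (all? λ v → ¬? (T? (E x v)))

  Cl? : ∀ v → Decidable (Cl G v)
  Cl? v x = leaf? x ×-dec (x ≼? v)

  Cl-nonempty : ∀ v → ∃ (Cl G v)
  Cl-nonempty = wfRec (λ w → ∃ (Cl G w)) step
    where
    step : ∀ w → WfRec _≺_ (λ w → ∃ (Cl G w)) w → ∃ (Cl G w)
    step w below with any? (λ v → T? (E w v))
    ... | yes (v , e) = let (x , leaf , x≼v) = below (edge⇒≺ e) in x , leaf , ≼-trans x≼v (e ◅ ε)
    ... | no ¬e       = w , to noOutEdge⇔Leaf (λ v e → ¬e (v , e)) , ε

  Minimal : (Fin n → Set) → Fin n → Set
  Minimal P m = P m × (∀ w → P w → w ≼[ E ] m → w ≡ m)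

  minimal-below : {P : Fin n → Set} → Decidable P → ∀ {w} → P w →
                  ∃[ m ] Minimal P m × m ≼[ E ] w
  minimal-below {P} P? {w} = wfRec Q step w
    where
    Q : Fin n → Set
    Q w = P w → ∃[ m ] Minimal P m × m ≼[ E ] w

    step : ∀ w → WfRec _≺_ Q w → Q w
    step w below pw with any? (λ v → P? v ×-dec (v ≼? w) ×-dec ¬? (v ≟ w))
    ... | yes (v , pv , v≼w , v≢w) =
      let (m , m-min , m≼v) = below (≼∧≢⇒≺ v≼w v≢w) pv in m , m-min , ≼-trans m≼v v≼w
    ... | no none = w , (pw , minimal) , ε
      where
      minimal : ∀ v → P v → v ≼[ E ] w → v ≡ w
      minimal v pv v≼w = decidable-stable (v ≟ w) λ v≢w → none (v , pv , v≼w , v≢w)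

module Clusters {n : ℕ} (G : DAG n) where
  open DAG G
  open Reachability G

  commonAnc? : {Y : Fin n → Set} → Decidable Y → Decidable (CommonAnc G Y)
  commonAnc? Y? q = all? λ y → Y? y →-dec (y ≼? q)

  -- IsLCA Y is literally Minimal (CommonAnc G Y).
  lca-least : {Y : Fin n → Set} → Decidable Y → ∀ {q w} →
              LcaIs G Y q → CommonAnc G Y w → q ≼[ E ] w
  lca-least Y? {w = w} (_ , unique) w-anc =
    let (m , m-lca , m≼w) = minimal-below (commonAnc? Y?) w-anc
    in subst (_≼[ E ] w) (unique m m-lca) m≼w

  lca-superset : {A B : Fin n → Set} → Decidable A → A Unary.⊆ B → ∀ {q} →
                 LcaIs G A q → CommonAnc G B q → LcaIs G B q
  lca-superset {A} {B} A? A⊆B {q} lcaA@((_ , A-min) , _) q-anc =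
    (q-anc , λ w w-anc → A-min w (restrict w-anc)) , unique
    where
    restrict : ∀ {w} → CommonAnc G B w → CommonAnc G A w
    restrict w-anc a a∈A = w-anc a (A⊆B a∈A)

    unique : ∀ q′ → IsLCA G B q′ → q′ ≡ q
    unique q′ (q′-anc , q′-min) = sym (q′-min q q-anc (lca-least A? lcaA (restrict q′-anc)))

  Cl-mono : ∀ {u v} → u ≼[ E ] v → Cl G u Unary.⊆ Cl G v
  Cl-mono u≼v (leaf , x≼u) = leaf , ≼-trans x≼u u≼v

  Cl-leaf : ∀ {x y} → Leaf G x → Cl G x y ⇔ y ≡ x
  Cl-leaf leaf = mk⇔ (λ (_ , y≼x) → leaf _ y≼x) λ { refl → leaf , ε }

  ⊆Cl-lca : {Y : Fin n → Set} → (∀ y → Y y → Leaf G y) → ∀ {q} →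
            LcaIs G Y q → Y Unary.⊆ Cl G q
  ⊆Cl-lca Y⊆X ((q-anc , _) , _) y∈Y = Y⊆X _ y∈Y , q-anc _ y∈Y

  Cl-lca-least : {Y : Fin n → Set} → Decidable Y → ∀ {q v} →
                 LcaIs G Y q → Y Unary.⊆ Cl G v → Cl G q Unary.⊆ Cl G v
  Cl-lca-least Y? lca Y⊆Cv = Cl-mono (lca-least Y? lca λ _ y∈Y → proj₂ (Y⊆Cv y∈Y))

  Cl-lca-Cl : ∀ {v q} → LcaIs G (Cl G v) q → ∀ x → Cl G v x ⇔ Cl G q x
  Cl-lca-Cl {v} lca x = mk⇔ (⊆Cl-lca (λ _ → proj₁) lca) (Cl-lca-least (Cl? v) lca λ c → c)

  cluster : Fin n → Subset n
  cluster v = subset (Cl? v)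

  cluster-rep : ∀ v → RepC G (cluster v) v
  cluster-rep v = ∈-subset⇔ (Cl? v)

  cluster∈𝒞G : ∀ v → 𝒞G G (cluster v)
  cluster∈𝒞G v = v , cluster-rep v

  ⊆cluster⇒⊆X : ∀ {T v} → T ⊆ cluster v → ∀ x → x ∈ T → X G x
  ⊆cluster⇒⊆X {v = v} T⊆Cv x x∈T = proj₁ (to (cluster-rep v x) (T⊆Cv x∈T))

module _ {n : ℕ} (G : DAG n) (k : ℕ) where
  open Reachability G
  open Clusters G

  strict⇒karySystem : StrictKLcaProperty G k → KarySystem (X G) k (𝒞G G)
  strict⇒karySystem (klca , _ , generated) =
    record { members = members ; KS = KS ; KR = KR ; KC = KC }
    where
    members : ∀ C → 𝒞G G C → (∀ x → x ∈ C → X G x) × Nonempty C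
    members C (v , rep) =
      let (x , x∈Cv) = Cl-nonempty v
      in (λ y y∈C → proj₁ (to (rep y) y∈C)) , x , from (rep x) x∈Cv

    KS : ∀ x → X G x → ∃ λ S → 𝒞G G S × (∀ y → y ∈ S ⇔ y ≡ x)
    KS x leaf = ⁅ x ⁆ , (x , λ y → ⇔-sym (Cl-leaf leaf) ⇔-∘ x∈⁅y⁆⇔x≡y) , λ y → x∈⁅y⁆⇔x≡y

    KR : ∀ C → 𝒞G G C → ∃ λ T → T ⊆ C × ∣ T ∣ ≤ k
           × (∀ C′ → 𝒞G G C′ → T ⊆ C′ → C ⊆ C′)
    KR C (v , rep) =
      let (U , (U⊆X , _ , |U|≤k) , q , lcaCv , lcaU) = generated v
          Cv⇔Cq = Cl-lca-Cl lcaCv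
          U⊆C : U ⊆ C
          U⊆C u∈U = from (rep _) (from (Cv⇔Cq _) (⊆Cl-lca U⊆X lcaU u∈U))
          least : ∀ C′ → 𝒞G G C′ → U ⊆ C′ → C ⊆ C′
          least C′ (v′ , rep′) U⊆C′ x∈C =
            from (rep′ _) (Cl-lca-least (_∈? U) lcaU (λ u∈U → to (rep′ _) (U⊆C′ u∈U))
                            (to (Cv⇔Cq _) (to (rep _) x∈C)))
      in U , U⊆C , |U|≤k , least

    KC : ∀ U → InXk (X G) k U → ∃ λ S → 𝒞G G S
           × (∀ x → x ∈ S ⇔ (X G x × (∀ C → 𝒞G G C → U ⊆ C → x ∈ C)))
    KC U U∈Xk@(U⊆X , _) =
      let (q , lcaU) = klca U U∈Xk
          ∈⋂ : ∀ x → x ∈ cluster q → X G x × (∀ C → 𝒞G G C → U ⊆ C → x ∈ C)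
          ∈⋂ x x∈Cq =
            let x∈Cq′ = to (cluster-rep q x) x∈Cq
            in proj₁ x∈Cq′ , λ C (v′ , rep′) U⊆C →
                 from (rep′ x) (Cl-lca-least (_∈? U) lcaU (λ u∈U → to (rep′ _) (U⊆C u∈U)) x∈Cq′)
          ⋂⊆ : ∀ x → X G x × (∀ C → 𝒞G G C → U ⊆ C → x ∈ C) → x ∈ cluster q
          ⋂⊆ x (_ , x∈⋂) = x∈⋂ (cluster q) (cluster∈𝒞G q)
                             λ u∈U → from (cluster-rep q _) (⊆Cl-lca U⊆X lcaU u∈U)
      in cluster q , cluster∈𝒞G q , λ x → mk⇔ (∈⋂ x) (⋂⊆ x)

  strict⇒identifiedByR : StrictKLcaProperty G k → IdentifiedByR G k
  strict⇒identifiedByR (_ , _ , generated) S = mk⇔ generator-of λ (_ , _ , q , _ , rep) → q , rep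
    where
    generator-of : 𝒞G G S → ∃ λ U → InXk (X G) k U × ∃ λ q → LcaIs G (_∈ U) q × RepC G S q
    generator-of (v , rep) =
      let (U , U∈Xk , q , lcaCv , lcaU) = generated v
      in U , U∈Xk , q , lcaU , λ x → Cl-lca-Cl lcaCv x ⇔-∘ rep x

  module _ (1≤k : 1 ≤ k) (klca : kLcaProperty G k) (K : KarySystem (X G) k (𝒞G G)) where
    open KarySystem K

    -- An empty (KR)-witness is replaced by a singleton of C(v), which needs 1 ≤ k.
    KR-generator : ∀ v → ∃ λ T → InXk (X G) k T × T ⊆ cluster v
                  × (∀ C → 𝒞G G C → T ⊆ C → cluster v ⊆ C)
    KR-generator v with KR (cluster v) (cluster∈𝒞G v)
    ... | T , T⊆Cv , |T|≤k , least with nonempty? T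
    ...   | yes nonempty = T , (⊆cluster⇒⊆X T⊆Cv , nonempty , |T|≤k) , T⊆Cv , least
    ...   | no empty =
      let (x , x∈Cv) = Cl-nonempty v
          x⊆Cv : ⁅ x ⁆ ⊆ cluster v
          x⊆Cv y∈x = from (cluster-rep v _) (subst (Cl G v) (sym (to x∈⁅y⁆⇔x≡y y∈x)) x∈Cv)
      in ⁅ x ⁆
       , (⊆cluster⇒⊆X x⊆Cv , (x , x∈⁅x⁆ x)
           , subst (_≤ k) (sym (∣⁅x⁆∣≡1 x)) 1≤k)
       , x⊆Cv
       , λ C C∈𝒞 _ → least C C∈𝒞 λ t∈T → ⊥-elim (empty (_ , t∈T))

    lca-generated : ∀ v → ∃ λ U → InXk (X G) k U × ∃ λ q → LcaIs G (Cl G v) q × LcaIs G (_∈ U) q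
    lca-generated v =
      let (T , T∈Xk@(T⊆X , _) , T⊆Cv , least) = KR-generator v
          (q , lcaT) = klca T T∈Xk
          Cv⊆Cq : Cl G v Unary.⊆ Cl G q
          Cv⊆Cq x∈Cv = to (cluster-rep q _)
            (least (cluster q) (cluster∈𝒞G q) (λ t∈T → from (cluster-rep q _) (⊆Cl-lca T⊆X lcaT t∈T))
                   (from (cluster-rep v _) x∈Cv))
          lcaCv = lca-superset (_∈? T) (λ t∈T → to (cluster-rep v _) (T⊆Cv t∈T)) lcaT
                    λ _ x∈Cv → proj₂ (Cv⊆Cq x∈Cv)
      in T , T∈Xk , q , lcaCv , lcaT

    karySystem⇒strict : StrictKLcaProperty G k
    karySystem⇒strict =
      klca , (λ v → let (_ , _ , q , lcaCv , _) = lca-generated v in q , lcaCv) , lca-generated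

proposition4 : {n : ℕ} (G : DAG n) (k : ℕ) → 1 ≤ k → kLcaProperty G k →
    (StrictKLcaProperty G k ⇔ KarySystem (X G) k (𝒞G G))
    × (StrictKLcaProperty G k → IdentifiedByR G k)
proposition4 G k 1≤k klca =
  mk⇔ (strict⇒karySystem G k) (karySystem⇒strict G k 1≤k klca) , strict⇒identifiedByR G k
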